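{- For every graph $G$, $\mathrm{prox}_1(G) > \dfrac{H_V(G)}{\Delta(G)+1}$.
   Context: All graphs are finite, connected, and without multiple edges. For a vertex $x$, $N(x)$ is its set of neighbours ($x\notin N(x)$), $N[x]=N(x)\cup\{x\}$, and for $S\subseteq V(G)$, $N[S]=\bigcup_{u\in S}N[u]$ and $\delta(S)=N[S]\setminus S$; $\Delta(G)$ is the maximum degree. The one-proximity game with $k$ cops: the robber first chooses a starting vertex; then in each round the cops choose (probe) vertices $u_1,\dots,u_k$ of $G$ (any vertices), and the cops win immediately if the robber's current vertex lies in $N[u_i]$ for some $i$; otherwise the robber moves to a vertex of $N[v]$, $v$ its current vertex. The robber is omniscient. $\mathrm{prox}_1(G)$ is the least positive integer $k$ such that $k$ cops have a strategy that wins after finitely many rounds. For $1\le k\le |V(G)|$, $\Phi_V(G,k)=\min_{S\subseteq V(G),|S|=k}|\delta(S)|$. For a function $f$ on integers, $H(f)$ is the largest integer $h$ for which there is $k_1$ with $f(k)\ge h$ for all $k_1\le k\le k_1+h-1$; $H_V(G)=H(k\mapsto \Phi_V(G,k))$ (with $k$ ranging over $1,\dots,|V(G)|$). -}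

module Defs where

open import Data.Nat using (ℕ; zero; suc; _+_; _*_; _≤_; _<_; _⊔_; _⊓_)
open import Data.Bool using (Bool; true; false; _∨_; _∧_; not; if_then_else_)
open import Data.Fin using (Fin; _≟_)
open import Data.Fin.Subset using (Subset; inside; outside; ∣_∣)
open import Data.List using (List; []; _∷_; map; foldr; filter; allFin; _++_)
open import Data.Bool.ListAction using (any)
open import Data.Vec using (Vec; []; _∷_; tabulate; lookup)
open import Data.Product using (Σ; ∃; _×_; _,_)
open import Relation.Nullary.Decidable using (⌊_⌋)
open import Relation.Binary.PropositionalEquality using (_≡_)

data Reach {n : ℕ} (adj : Fin n → Fin n → Bool) : Fin n → Fin n → Set where
  here  : ∀ {x} → Reach adj x x
  step  : ∀ {x y z} → adj x y ≡ true → Reach adj y z → Reach adj x z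

record Graph : Set where
  field
    n        : ℕ
    adj      : Fin n → Fin n → Bool
    sym      : ∀ x y → adj x y ≡ adj y x
    irrefl   : ∀ x → adj x x ≡ false
    connected : ∀ x y → Reach adj x y

open Graph public

closedAdj : (G : Graph) → Fin (n G) → Fin (n G) → Bool
closedAdj G x y = ⌊ x ≟ y ⌋ ∨ adj G x y

degree : (G : Graph) → Fin (n G) → ℕ
degree G x = Data.List.length (filter (λ y → adj G x y Data.Bool.≟ true) (allFin (n G)))

maxDegree : Graph → ℕ
maxDegree G = foldr _⊔_ 0 (map (degree G) (allFin (n G)))

isIn : ∀ {m} → Subset m → Fin m → Bool
isIn S v with lookup S v
... | inside  = true
... | outside = false

boundary : (G : Graph) → Subset (n G) → Subset (n G)
boundary G S = tabulate λ v →
  if not (isIn S v) ∧ any (λ u → isIn S u ∧ closedAdj G u v) (allFin (n G))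
  then inside else outside

allSubsets : (m : ℕ) → List (Subset m)
allSubsets zero    = [] ∷ []
allSubsets (suc m) = map (outside ∷_) (allSubsets m) ++ map (inside ∷_) (allSubsets m)

-- The fold starts at n(G), an upper bound of every |δ(S)|, so for
-- 1 ≤ k ≤ n(G) (the range where Φ_V is defined; the set of S is then
-- nonempty) this is exactly the minimum.
PhiV : (G : Graph) → ℕ → ℕ
PhiV G k = foldr _⊓_ (n G)
  (map (λ S → ∣ boundary G S ∣)
       (filter (λ S → ∣ S ∣ Data.Nat.≟ k) (allSubsets (n G))))

HAdmissible : (ℕ → ℕ) → (N : ℕ) → ℕ → Set
HAdmissible f N h = ∃ λ k1 → 1 ≤ k1 × k1 + h ≤ suc N ×
  (∀ k → k1 ≤ k → k < k1 + h → h ≤ f k)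

IsH : (ℕ → ℕ) → (N : ℕ) → ℕ → Set
IsH f N h = HAdmissible f N h × (∀ h' → HAdmissible f N h' → h' ≤ h)

IsHV : Graph → ℕ → Set
IsHV G h = IsH (PhiV G) (n G) h

-- The robber is invisible and omniscient, and the only information the
-- cops ever receive is "not caught yet"; hence a (deterministic) cop
-- strategy is just a sequence of probe tuples, round i ↦ (u_1,…,u_k).

IsRobberWalk : (G : Graph) → (ℕ → Fin (n G)) → Set
IsRobberWalk G v = ∀ i → closedAdj G (v i) (v (suc i)) ≡ true

CopsWin : (G : Graph) → ℕ → Set
CopsWin G k = ∃ λ (T : ℕ) → ∃ λ (strat : ℕ → Fin k → Fin (n G)) →
  ∀ v → IsRobberWalk G v →
    ∃ λ i → i < T × ∃ λ (j : Fin k) → closedAdj G (strat i j) (v i) ≡ true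

IsProx1 : Graph → ℕ → Set
IsProx1 G p = 1 ≤ p × CopsWin G p × (∀ k → 1 ≤ k → CopsWin G k → p ≤ k)

-- Suppose k(Δ+1) ≤ h and track the set of vertices an uncaught robber may occupy.
-- It starts as all of V; each round removes the probed closed neighbourhoods
-- (at most k(Δ+1) ≤ h vertices) and the survivors A spread to N[A], of size
-- |A| + |δ(A)|.  Given a window [k₁, k₁ + h) on which Φ_V ≥ h, this set never
-- drops below k₁ + h vertices, so some robber position survives every round,
-- and tracing it back gives a walk that no probe ever catches.

module Submission where

open import Defs
open import Data.Nat using (ℕ; suc; _*_; _<_)
open import Data.Nat using (zero; _+_; _≤_; _⊔_; _⊓_; z≤n; s≤s; _≤?_; _<?_)
open import Data.Nat.Properties
open import Data.Bool using (Bool; true; false; _∨_; _∧_; not; if_then_else_)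
open import Data.Bool.Properties using (∨-zeroʳ; not-injective)
import Data.Bool as Bool
open import Data.Fin using (Fin; zero; suc)
import Data.Fin as Fin
open import Data.Fin.Subset using (Subset; ∣_∣)
open import Data.List using (List; []; _∷_; map; foldr; filter; allFin; length)
import Data.List as List
open import Data.List.Properties using (length-tabulate)
open import Data.List.Membership.Propositional using (_∈_)
open import Data.List.Membership.Propositional.Properties
  using (∈-map⁺; ∈-++⁺ˡ; ∈-++⁺ʳ; ∈-filter⁺; ∈-allFin)
open import Data.List.Relation.Unary.Any using (here; there)
open import Data.Bool.ListAction using (any)
open import Data.Vec using (tabulate; lookup)
import Data.Vec as Vec
open import Data.Vec.Properties using (lookup∘tabulate)
open import Data.Product using (∃; _×_; _,_; proj₁; proj₂)
open import Data.Empty using (⊥-elim)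
open import Data.Sum using (inj₁; inj₂)
open import Function using (_∘_)
open import Relation.Nullary using (yes; no; ¬_)
open import Relation.Nullary.Decidable using (⌊_⌋; dec-true; isYes≗does)
open import Relation.Binary.PropositionalEquality as ≡
  using (_≡_; _≢_; refl; cong; cong₂; subst; trans)

size : ∀ {m} → (Fin m → Bool) → ℕ
size P = ∣ tabulate P ∣

_⇒ᵇ_ : ∀ {m} → (Fin m → Bool) → (Fin m → Bool) → Set
P ⇒ᵇ Q = ∀ x → P x ≡ true → Q x ≡ true

size-cong : ∀ {m} {P Q : Fin m → Bool} → (∀ x → P x ≡ Q x) → size P ≡ size Q
size-cong {zero} eq = refl
size-cong {suc m} {P} {Q} eq
  with P zero | Q zero | eq zero | size-cong {P = P ∘ suc} {Q ∘ suc} (eq ∘ suc)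
... | true  | .true  | refl | ih = cong suc ih
... | false | .false | refl | ih = ih

size-mono : ∀ {m} {P Q : Fin m → Bool} → P ⇒ᵇ Q → size P ≤ size Q
size-mono {zero} P⇒Q = z≤n
size-mono {suc m} {P} {Q} P⇒Q
  with P zero | Q zero | P⇒Q zero | size-mono {P = P ∘ suc} {Q ∘ suc} (P⇒Q ∘ suc)
... | true  | true  | _   | ih = s≤s ih
... | true  | false | imp | _  with () ← imp refl
... | false | true  | _   | ih = m≤n⇒m≤1+n ih
... | false | false | _   | ih = ih

size-∨ : ∀ {m} (P Q : Fin m → Bool) → size (λ x → P x ∨ Q x) ≤ size P + size Q
size-∨ {zero} P Q = z≤n
size-∨ {suc m} P Q with P zero | Q zero | size-∨ (P ∘ suc) (Q ∘ suc)
... | true  | true  | ih = s≤s (≤-trans ih (≤-trans (n≤1+n _) (≤-reflexive (≡.sym (+-suc _ _)))))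
... | true  | false | ih = s≤s ih
... | false | true  | ih = ≤-trans (s≤s ih) (≤-reflexive (≡.sym (+-suc _ _)))
... | false | false | ih = ih

size-split : ∀ {m} {P Q : Fin m → Bool} → P ⇒ᵇ Q →
             size Q ≡ size P + size (λ x → not (P x) ∧ Q x)
size-split {zero} P⇒Q = refl
size-split {suc m} {P} {Q} P⇒Q
  with P zero | Q zero | P⇒Q zero | size-split {P = P ∘ suc} {Q ∘ suc} (P⇒Q ∘ suc)
... | true  | true  | _   | ih = cong suc ih
... | true  | false | imp | _  with () ← imp refl
... | false | true  | _   | ih = trans (cong suc ih) (≡.sym (+-suc _ _))
... | false | false | _   | ih = ih

size-true : ∀ {m} → size {m} (λ _ → true) ≡ m
size-true {zero}  = refl
size-true {suc m} = cong suc (size-true {m})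

size-false : ∀ {m} → size {m} (λ _ → false) ≡ 0
size-false {zero}  = refl
size-false {suc m} = size-false {m}

size-≟ : ∀ {m} (u : Fin m) → size (λ v → ⌊ u Fin.≟ v ⌋) ≡ 1
size-≟ {suc m} zero    = cong suc (size-false {m})
size-≟         (suc u) = trans (size-cong (λ v → ⌊suc≟suc⌋ u v)) (size-≟ u)
  where
  ⌊suc≟suc⌋ : ∀ {m} (u v : Fin m) → ⌊ suc u Fin.≟ suc v ⌋ ≡ ⌊ u Fin.≟ v ⌋
  ⌊suc≟suc⌋ u v with u Fin.≟ v
  ... | yes _ = refl
  ... | no  _ = refl

size-pos⇒∃ : ∀ {m} (P : Fin m → Bool) → 1 ≤ size P → ∃ λ x → P x ≡ true
size-pos⇒∃ {suc m} P 1≤size with P zero in eq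
... | true  = zero , eq
... | false with x , Px ← size-pos⇒∃ (P ∘ suc) 1≤size = suc x , Px

size-any : ∀ {a} {A : Set a} {m} (P : A → Fin m → Bool) (b : ℕ) (xs : List A) →
           (∀ x → size (P x) ≤ b) → size (λ v → any (λ x → P x v) xs) ≤ length xs * b
size-any {m = m} P b []       _       = ≤-reflexive (size-false {m})
size-any         P b (x ∷ xs) size≤b = begin
  size (λ v → P x v ∨ any (λ y → P y v) xs)         ≤⟨ size-∨ (P x) _ ⟩
  size (P x) + size (λ v → any (λ y → P y v) xs)    ≤⟨ +-mono-≤ (size≤b x) (size-any P b xs size≤b) ⟩
  b + length xs * b                                 ∎
  where open ≤-Reasoning

length-filter-tabulate : ∀ {a} {A : Set a} {m} (P : A → Bool) (g : Fin m → A) →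
  length (filter (λ y → P y Bool.≟ true) (List.tabulate g)) ≡ size (P ∘ g)
length-filter-tabulate {m = zero}  P g = refl
length-filter-tabulate {m = suc m} P g with P (g zero)
... | true  = cong suc (length-filter-tabulate P (g ∘ suc))
... | false = length-filter-tabulate P (g ∘ suc)

any⁺ : ∀ {a} {A : Set a} (P : A → Bool) {x xs} → x ∈ xs → P x ≡ true → any P xs ≡ true
any⁺ P {xs = _ ∷ xs} (here refl) Px = cong (_∨ any P xs) Px
any⁺ P {xs = y ∷ _} (there x∈xs) Px = trans (cong (P y ∨_) (any⁺ P x∈xs Px)) (∨-zeroʳ (P y))

any⁻ : ∀ {a} {A : Set a} (P : A → Bool) xs → any P xs ≡ true → ∃ λ x → P x ≡ true
any⁻ P (x ∷ xs) any≡true with P x in Px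
... | true  = x , Px
... | false = any⁻ P xs any≡true

any-cong : ∀ {a} {A : Set a} {P Q : A → Bool} → (∀ x → P x ≡ Q x) → ∀ xs → any P xs ≡ any Q xs
any-cong P≡Q []       = refl
any-cong P≡Q (x ∷ xs) = cong₂ _∨_ (P≡Q x) (any-cong P≡Q xs)

foldr-⊓≤ : ∀ b {x} xs → x ∈ xs → foldr _⊓_ b xs ≤ x
foldr-⊓≤ b (x ∷ xs) (here refl) = m⊓n≤m x _
foldr-⊓≤ b (y ∷ xs) (there x∈xs) = ≤-trans (m⊓n≤n y _) (foldr-⊓≤ b xs x∈xs)

≤foldr-⊔ : ∀ b {x} xs → x ∈ xs → x ≤ foldr _⊔_ b xs
≤foldr-⊔ b (x ∷ xs) (here refl) = m≤m⊔n x _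
≤foldr-⊔ b (y ∷ xs) (there x∈xs) = ≤-trans (≤foldr-⊔ b xs x∈xs) (m≤n⊔m y _)

∧-≡true⁻ : ∀ {a b} → a ∧ b ≡ true → a ≡ true × b ≡ true
∧-≡true⁻ {true} b≡true = refl , b≡true

∧-≡true⁺ : ∀ {a b} → a ≡ true → b ≡ true → a ∧ b ≡ true
∧-≡true⁺ refl refl = refl

if-then-true-else-false : ∀ b → (if b then true else false) ≡ b
if-then-true-else-false true  = refl
if-then-true-else-false false = refl

isIn-tabulate : ∀ {m} (P : Fin m → Bool) v → isIn (tabulate P) v ≡ P v
isIn-tabulate P v with lookup (tabulate P) v | lookup∘tabulate P v
... | true  | eq = eq
... | false | eq = eq

∈-allSubsets : ∀ {m} (S : Subset m) → S ∈ allSubsets m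
∈-allSubsets Vec.[]           = here refl
∈-allSubsets (false Vec.∷ S) = ∈-++⁺ˡ (∈-map⁺ (false Vec.∷_) (∈-allSubsets S))
∈-allSubsets (true  Vec.∷ S) = ∈-++⁺ʳ _ (∈-map⁺ (true Vec.∷_) (∈-allSubsets S))

module _ (G : Graph) where

  closedAdj-refl : ∀ x → closedAdj G x x ≡ true
  closedAdj-refl x = cong (_∨ adj G x x) (trans (isYes≗does (x Fin.≟ x)) (dec-true (x Fin.≟ x) refl))

  degree≡size-adj : ∀ x → degree G x ≡ size (adj G x)
  degree≡size-adj x = length-filter-tabulate (adj G x) (λ y → y)

  degree≤maxDegree : ∀ x → degree G x ≤ maxDegree G
  degree≤maxDegree x = ≤foldr-⊔ 0 _ (∈-map⁺ (degree G) (∈-allFin x))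

  size-closedAdj≤1+Δ : ∀ x → size (closedAdj G x) ≤ suc (maxDegree G)
  size-closedAdj≤1+Δ x = begin
    size (closedAdj G x)                          ≤⟨ size-∨ (λ y → ⌊ x Fin.≟ y ⌋) (adj G x) ⟩
    size (λ y → ⌊ x Fin.≟ y ⌋) + size (adj G x)   ≡⟨ cong₂ _+_ (size-≟ x) (≡.sym (degree≡size-adj x)) ⟩
    suc (degree G x)                              ≤⟨ s≤s (degree≤maxDegree x) ⟩
    suc (maxDegree G)                             ∎
    where open ≤-Reasoning

  closedNbhd : (Fin (n G) → Bool) → Fin (n G) → Bool
  closedNbhd P v = any (λ u → P u ∧ closedAdj G u v) (allFin (n G))

  ⇒ᵇ-closedNbhd : ∀ P → P ⇒ᵇ closedNbhd P
  ⇒ᵇ-closedNbhd P v Pv = any⁺ _ (∈-allFin v) (∧-≡true⁺ Pv (closedAdj-refl v))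

  ∣boundary-tabulate∣ : ∀ P → ∣ boundary G (tabulate P) ∣ ≡ size (λ v → not (P v) ∧ closedNbhd P v)
  ∣boundary-tabulate∣ P = size-cong λ v → trans (if-then-true-else-false _)
    (cong₂ (λ b c → not b ∧ c) (isIn-tabulate P v)
           (any-cong (λ u → cong (_∧ closedAdj G u v) (isIn-tabulate P u)) (allFin (n G))))

  size-closedNbhd : ∀ P → size (closedNbhd P) ≡ size P + ∣ boundary G (tabulate P) ∣
  size-closedNbhd P = trans (size-split (⇒ᵇ-closedNbhd P)) (cong (size P +_) (≡.sym (∣boundary-tabulate∣ P)))

  PhiV≤∣boundary∣ : ∀ S → PhiV G ∣ S ∣ ≤ ∣ boundary G S ∣
  PhiV≤∣boundary∣ S =
    foldr-⊓≤ (n G) _ (∈-map⁺ (λ T → ∣ boundary G T ∣) (∈-filter⁺ _ (∈-allSubsets S) refl))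

  size+PhiV≤size-closedNbhd : ∀ P → size P + PhiV G (size P) ≤ size (closedNbhd P)
  size+PhiV≤size-closedNbhd P = begin
    size P + PhiV G (size P)                ≤⟨ +-monoʳ-≤ (size P) (PhiV≤∣boundary∣ (tabulate P)) ⟩
    size P + ∣ boundary G (tabulate P) ∣    ≡⟨ ≡.sym (size-closedNbhd P) ⟩
    size (closedNbhd P)                     ∎
    where open ≤-Reasoning

  PhiV-n≡0 : PhiV G (n G) ≡ 0
  PhiV-n≡0 = n≤0⇒n≡0 (begin
    PhiV G (n G)                                       ≡⟨ cong (PhiV G) (≡.sym (size-true {n G})) ⟩
    PhiV G (size {n G} (λ _ → true))                   ≤⟨ PhiV≤∣boundary∣ (tabulate (λ _ → true)) ⟩
    ∣ boundary G (tabulate (λ _ → true)) ∣             ≡⟨ ∣boundary-tabulate∣ (λ _ → true) ⟩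
    size {n G} (λ _ → false)                           ≡⟨ size-false {n G} ⟩
    0                                                  ∎)
    where open ≤-Reasoning

HWindow : (ℕ → ℕ) → ℕ → ℕ → Set
HWindow f k₁ h = ∀ k → k₁ ≤ k → k < k₁ + h → h ≤ f k

-- The invariant is k₁ + h ≤ d i: it gives k₁ ≤ a i, and then either a i lies in
-- the window, so Φ (a i) ≥ h, or a i ≥ k₁ + h already.
window-invariant : (Φ : ℕ → ℕ) {k₁ h : ℕ} → HWindow Φ k₁ h →
  (d a : ℕ → ℕ) → k₁ + h ≤ d 0 → (∀ i → d i ≤ a i + h) → (∀ i → a i + Φ (a i) ≤ d (suc i)) →
  ∀ i → k₁ ≤ a i
window-invariant Φ {k₁} {h} window d a k₁+h≤d₀ d≤a+h a+Φa≤d = k₁≤a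
  where
  k₁+h≤d : ∀ i → k₁ + h ≤ d i
  k₁≤a : ∀ i → k₁ ≤ a i
  k₁≤a i = +-cancelʳ-≤ h k₁ (a i) (≤-trans (k₁+h≤d i) (d≤a+h i))
  k₁+h≤d zero    = k₁+h≤d₀
  k₁+h≤d (suc i) with a i <? k₁ + h
  ... | yes a<k₁+h = ≤-trans (+-mono-≤ (k₁≤a i) (window (a i) (k₁≤a i) a<k₁+h)) (a+Φa≤d i)
  ... | no  a≮k₁+h = ≤-trans (≮⇒≥ a≮k₁+h) (≤-trans (m≤m+n (a i) _) (a+Φa≤d i))

prolong : ∀ {a} {A : Set a} → (ℕ → A) → ℕ → A → ℕ → A
prolong v t x i with i ≤? t
... | yes _ = v i
... | no  _ = x

prolong-≤ : ∀ {a} {A : Set a} (v : ℕ → A) {t} x {i} → i ≤ t → prolong v t x i ≡ v i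
prolong-≤ v {t} x {i} i≤t with i ≤? t
... | yes _   = refl
... | no  i≰t = ⊥-elim (i≰t i≤t)

prolong-> : ∀ {a} {A : Set a} (v : ℕ → A) {t} x {i} → t < i → prolong v t x i ≡ x
prolong-> v {t} x {i} t<i with i ≤? t
... | yes i≤t = ⊥-elim (<⇒≱ t<i i≤t)
... | no  _   = refl

prolong-walk : (G : Graph) {v : ℕ → Fin (n G)} {t : ℕ} {x : Fin (n G)} → IsRobberWalk G v →
               closedAdj G (v t) x ≡ true → IsRobberWalk G (prolong v t x)
prolong-walk G {v} {t} {x} walk vt~x i with i ≤? t | suc i ≤? t
... | yes _   | yes _    = walk i
... | yes i≤t | no  i≮t  = subst (λ j → closedAdj G (v j) x ≡ true) (≤-antisym (≮⇒≥ i≮t) i≤t) vt~x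
... | no  i≰t | yes i<t  = ⊥-elim (i≰t (<⇒≤ i<t))
... | no  _   | no  _    = closedAdj-refl G x

module Pursuit (G : Graph) (probed : ℕ → Fin (n G) → Bool) where

  possible uncaught : ℕ → Fin (n G) → Bool
  possible zero    v = true
  possible (suc i) v = closedNbhd G (uncaught i) v
  uncaught i v = possible i v ∧ not (probed i v)

  size-possible≤ : ∀ i → size (possible i) ≤ size (uncaught i) + size (probed i)
  size-possible≤ i = ≤-trans (size-mono possible⇒uncaught∨probed) (size-∨ (uncaught i) (probed i))
    where
    possible⇒uncaught∨probed : possible i ⇒ᵇ (λ v → uncaught i v ∨ probed i v)
    possible⇒uncaught∨probed v possible-v with probed i v
    ... | true  = ∨-zeroʳ _
    ... | false = cong (λ b → b ∧ true ∨ false) possible-v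

  evading-walk : ∀ t x → uncaught t x ≡ true →
    ∃ λ v → IsRobberWalk G v × v t ≡ x × (∀ i → i ≤ t → uncaught i (v i) ≡ true)
  evading-walk zero x uncaught-x =
    (λ _ → x) , (λ _ → closedAdj-refl G x) , refl , λ { zero _ → uncaught-x }
  evading-walk (suc t) x uncaught-x
    with u , u-step ← any⁻ _ (allFin (n G)) (proj₁ (∧-≡true⁻ uncaught-x))
    with uncaught-u , u~x ← ∧-≡true⁻ u-step
    with v , walk , vt≡u , evades ← evading-walk t u uncaught-u
    = prolong v t x
    , prolong-walk G walk (subst (λ y → closedAdj G y x ≡ true) (≡.sym vt≡u) u~x)
    , prolong-> v x (n<1+n t)
    , evades′
    where
    evades′ : ∀ i → i ≤ suc t → uncaught i (prolong v t x i) ≡ true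
    evades′ i i≤1+t with m≤n⇒m<n∨m≡n i≤1+t
    ... | inj₁ i<1+t = subst (λ y → uncaught i y ≡ true) (≡.sym (prolong-≤ v x (m<1+n⇒m≤n i<1+t)))
                             (evades i (m<1+n⇒m≤n i<1+t))
    ... | inj₂ refl  = subst (λ y → uncaught (suc t) y ≡ true) (≡.sym (prolong-> v x (n<1+n t))) uncaught-x

  size-uncaught≥ : ∀ {k₁ h} → k₁ + h ≤ n G → HWindow (PhiV G) k₁ h →
    (∀ i → size (probed i) ≤ h) → ∀ i → k₁ ≤ size (uncaught i)
  size-uncaught≥ {k₁} {h} k₁+h≤n window probed≤h =
    window-invariant (PhiV G) window (size ∘ possible) (size ∘ uncaught)
      (subst (k₁ + h ≤_) (≡.sym (size-true {n G})) k₁+h≤n)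
      (λ i → ≤-trans (size-possible≤ i) (+-monoʳ-≤ _ (probed≤h i)))
      (λ i → size+PhiV≤size-closedNbhd G (uncaught i))

  robber-evades : ∀ {k₁ h} → 1 ≤ k₁ → k₁ + h ≤ n G → HWindow (PhiV G) k₁ h →
    (∀ i → size (probed i) ≤ h) →
    ∀ t → ∃ λ v → IsRobberWalk G v × (∀ i → i ≤ t → probed i (v i) ≡ false)
  robber-evades 1≤k₁ k₁+h≤n window probed≤h t
    with x , uncaught-x ← size-pos⇒∃ (uncaught t) (≤-trans 1≤k₁ (size-uncaught≥ k₁+h≤n window probed≤h t))
    with v , walk , _ , evades ← evading-walk t x uncaught-x
    = v , walk , λ i i≤t → not-injective (proj₂ (∧-≡true⁻ (evades i i≤t)))

probedBy : (G : Graph) {k : ℕ} → (ℕ → Fin k → Fin (n G)) → ℕ → Fin (n G) → Bool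
probedBy G {k} strat i v = any (λ j → closedAdj G (strat i j) v) (allFin k)

size-probedBy≤ : (G : Graph) {k : ℕ} (strat : ℕ → Fin k → Fin (n G)) →
                 ∀ i → size (probedBy G strat i) ≤ k * suc (maxDegree G)
size-probedBy≤ G {k} strat i = ≤-trans
  (size-any (λ j → closedAdj G (strat i j)) (suc (maxDegree G)) (allFin k)
            (λ j → size-closedAdj≤1+Δ G (strat i j)))
  (≤-reflexive (cong (_* suc (maxDegree G)) (length-tabulate {n = k} (λ j → j))))

window-fits : (G : Graph) {k₁ h : ℕ} → 1 ≤ h → k₁ + h ≤ suc (n G) →
              HWindow (PhiV G) k₁ h → k₁ + h ≤ n G
window-fits G {k₁} {h} 1≤h k₁+h≤1+n window = m<1+n⇒m≤n (≤∧≢⇒< k₁+h≤1+n k₁+h≢1+n)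
  where
  k₁+h≢1+n : k₁ + h ≢ suc (n G)
  k₁+h≢1+n k₁+h≡1+n = <⇒≱ 1≤h (begin
    h               ≤⟨ window (n G) (m<1+n⇒m≤n (subst (k₁ <_) k₁+h≡1+n (m<m+n k₁ 1≤h)))
                                    (≤-reflexive (≡.sym k₁+h≡1+n)) ⟩
    PhiV G (n G)    ≡⟨ PhiV-n≡0 G ⟩
    0               ∎)
    where open ≤-Reasoning

cops-lose : (G : Graph) {k h : ℕ} → 1 ≤ k → k * suc (maxDegree G) ≤ h →
            HAdmissible (PhiV G) (n G) h → ¬ CopsWin G k
cops-lose G 1≤k k[1+Δ]≤h (k₁ , 1≤k₁ , k₁+h≤1+n , window) (T , strat , cops-win)
  with v , walk , evades ← Pursuit.robber-evades G (probedBy G strat) 1≤k₁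
         (window-fits G (≤-trans (*-mono-≤ 1≤k (s≤s z≤n)) k[1+Δ]≤h) k₁+h≤1+n window) window
         (λ i → ≤-trans (size-probedBy≤ G strat i) k[1+Δ]≤h) T
  with i , i<T , j , caught ← cops-win v walk
  with () ← trans (≡.sym (evades i (<⇒≤ i<T))) (any⁺ _ (∈-allFin j) caught)

mainTheorem15 : (G : Graph) (p h : ℕ) → IsProx1 G p → IsHV G h →
                h < p * suc (maxDegree G)
mainTheorem15 G p h (1≤p , p-cops-win , _) (h-admissible , _) =
  ≰⇒> λ p[1+Δ]≤h → cops-lose G 1≤p p[1+Δ]≤h h-admissible p-cops-win
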